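{- Let $P$ be a finite poset and let $P_\chi$ be a $\chi$-minimal model of $P$. If $h, h' : P \to \mathbb{Z}$ are two functions whose restrictions to $P_\chi$ coincide, $h|_{P_\chi} = h'|_{P_\chi}$, then \[ \int_{P} h \, d\chi = \int_{P} h' \, d\chi . \]
   Context: For a finite poset $P$, the zeta matrix $\zeta : P \times P \to \mathbb{Q}$ is given by $\zeta(x,y) = 1$ if $x \le y$ and $0$ otherwise; it is invertible, and the Euler characteristic of $P$ is $\chi(P) = \sum_{x,y \in P} \zeta^{ -1}(x,y)$ (with $\chi(\emptyset)=0$). A point $x$ of a finite poset $P$ is a $\chi$-point if $\chi(P_{>x}) = 1$, where $P_{>x} = \{y \in P \mid y > x\}$ with the induced order. A $\chi$-minimal model $P_\chi$ of $P$ is a subposet obtained by removing $\chi$-points one at a time (at each step removing a point that is a $\chi$-point of the current subposet with the induced order) until the remaining subposet has no $\chi$-points. A filter of $P$ is an upward closed subset. For $Q \subseteq P$, $\delta_Q$ is its indicator function. Every $f : P \to \mathbb{Z}$ can be written as $f = \sum_i a_i \delta_{Q_i}$ with $a_i \in \mathbb{Z}$ and $Q_i$ filters of $P$; the Euler calculus of $f$ is $\int_P f\, d\chi = \sum_i a_i \chi(Q_i)$, independent of the decomposition. -}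

module Defs where

open import Data.Nat using (ℕ; zero; suc)
open import Data.Fin using (Fin; zero; suc; _≟_)
open import Data.Bool using (Bool; true; false; T; _∧_; not; if_then_else_)
open import Data.Integer using (ℤ; +_; _+_; _*_; -_)
open import Data.List using (List; []; _∷_)
open import Data.List.Relation.Unary.All using (All)
open import Data.Product using (_×_; _,_; proj₁; proj₂; ∃)
open import Relation.Binary.PropositionalEquality using (_≡_; _≢_)
open import Relation.Nullary.Decidable using (⌊_⌋)
open import Relation.Nullary using (¬_)

record FinPoset : Set where
  field
    size    : ℕ
    leq     : Fin size → Fin size → Bool
    refl    : ∀ x → T (leq x x)
    antisym : ∀ x y → T (leq x y) → T (leq y x) → x ≡ y
    trans   : ∀ x y z → T (leq x y) → T (leq y z) → T (leq x z)

sumFin : ∀ {n} → (Fin n → ℤ) → ℤ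
sumFin {zero}  f = + 0
sumFin {suc n} f = f zero + sumFin (λ i → f (suc i))

Subset : FinPoset → Set
Subset P = Fin (FinPoset.size P) → Bool

⟦_⟧ : Bool → ℤ
⟦ true ⟧  = + 1
⟦ false ⟧ = + 0

module _ (P : FinPoset) where
  open FinPoset P

  Mat : Set
  Mat = Fin size → Fin size → ℤ

  _·_ : Mat → Mat → Mat
  (A · B) x y = sumFin (λ z → A x z * B z y)

  idMat : Mat
  idMat x y = ⟦ ⌊ x ≟ y ⌋ ⟧

  lt : Fin size → Fin size → Bool
  lt x y = leq x y ∧ not ⌊ x ≟ y ⌋

  -- For a subposet Q (induced order), the zeta matrix is ζ_Q = I + N_Q
  -- with N_Q(x,y) = [x<y] (x,y ∈ Q) strictly upper triangular, hence
  -- nilpotent (N_Q^size = 0); its inverse is the finite Neumann series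
  -- ζ_Q⁻¹ = Σ_{k < size} (-N_Q)^k.  We index it by all of Fin size;
  -- only entries with x,y ∈ Q are used.
  negN : Subset P → Mat
  negN Q x y = - ⟦ Q x ∧ Q y ∧ lt x y ⟧

  pow : Mat → ℕ → Mat
  pow A zero    = idMat
  pow A (suc k) = A · pow A k

  neumann : Mat → ℕ → Mat
  neumann A zero    x y = + 0
  neumann A (suc k) x y = pow A k x y + neumann A k x y

  zetaInv : Subset P → Mat
  zetaInv Q = neumann (negN Q) size

  χ : Subset P → ℤ
  χ Q = sumFin (λ x → sumFin (λ y → ⟦ Q x ∧ Q y ⟧ * zetaInv Q x y))

  above : Subset P → Fin size → Subset P
  above Q x y = Q y ∧ lt x y

  IsChiPoint : Subset P → Fin size → Set
  IsChiPoint Q x = T (Q x) × (χ (above Q x) ≡ + 1)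

  remove : Subset P → Fin size → Subset P
  remove Q x y = Q y ∧ not ⌊ x ≟ y ⌋

  data ChiReduces : Subset P → Subset P → Set where
    done : ∀ {Q} → (∀ x → ¬ IsChiPoint Q x) → ChiReduces Q Q
    step : ∀ {Q R} x → IsChiPoint Q x → ChiReduces (remove Q x) R → ChiReduces Q R

  full : Subset P
  full _ = true

  IsChiMinimalModel : Subset P → Set
  IsChiMinimalModel R = ChiReduces full R

  IsFilter : Subset P → Set
  IsFilter Q = ∀ x y → T (Q x) → T (leq x y) → T (Q y)

  evalDecomp : List (ℤ × Subset P) → Fin size → ℤ
  evalDecomp []            x = + 0
  evalDecomp ((a , Q) ∷ d) x = a * ⟦ Q x ⟧ + evalDecomp d x

  valueDecomp : List (ℤ × Subset P) → ℤ
  valueDecomp []            = + 0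
  valueDecomp ((a , Q) ∷ d) = a * χ Q + valueDecomp d

  IsFilterDecomp : (Fin size → ℤ) → List (ℤ × Subset P) → Set
  IsFilterDecomp f d = All (λ aQ → IsFilter (proj₂ aQ)) d × (∀ x → f x ≡ evalDecomp d x)

  -- EulerIntegral f v : v = ∫_P f dχ, i.e. v = Σ a_i χ(Q_i) for some
  -- decomposition f = Σ a_i δ_{Q_i} into filters.
  EulerIntegral : (Fin size → ℤ) → ℤ → Set
  EulerIntegral f v = ∃ λ d → IsFilterDecomp f d × (valueDecomp d ≡ v)

-- The argument runs through weightings: a weighting of a subposet Q is a
-- c : Q → ℤ with Σ_{z ∈ Q, z ≥ x} c(z) = 1 for all x ∈ Q. The row sums of
-- ζ_Q⁻¹ form one, since the strict part of ζ_Q is nilpotent; weightings are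
-- unique by induction down the order, hence χ(Q) = Σ_Q c for every weighting
-- c of Q. A weighting of Q restricts to one of each filter
-- of Q; for the filter Q_{>x} the equation at x becomes c(x) + χ(Q_{>x}) = 1,
-- so c vanishes at the χ-points of Q, and deleting a zero of c leaves a
-- weighting of what remains. For the weighting w of P, filter by filter
-- ∫_P h dχ = Σ_P h w, and deleting χ-points one at a time does not change
-- Σ h w, so ∫_P h dχ = Σ_{P_χ} h w depends only on h restricted to P_χ.

module Submission where

open import Defs
open import Algebra.Bundles using (CommutativeMonoid)
open import Data.Bool using (Bool; true; false; T; _∧_; not)
open import Data.Bool.Properties
  using (T-≡; T-∧; ⇔→≡; ∧-assoc; ∧-zeroʳ; ∧-identityʳ; ∧-commutativeMonoid)
open import Data.Fin using (Fin; zero; suc; _≟_)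
open import Data.Fin.Induction using (spo-noetherian)
open import Data.Fin.Properties using (suc-injective)
open import Data.Fin.Subset using (_∈_; ∣_∣)
open import Data.Fin.Subset.Properties using (p⊂q⇒∣p∣<∣q∣; ⊆⊤; ∈⊤; ∣⊤∣≡n)
open import Data.Integer using (ℤ; +_; _+_; _*_; -_; -1ℤ)
open import Data.Integer.Properties as ℤ
  using ( +-identityˡ; +-identityʳ; *-identityˡ; *-zeroʳ; *-assoc; *-distribˡ-+; *-distribʳ-+
        ; neg-distribˡ-*; -1*i≡-i)
open import Data.List using ([]; _∷_)
open import Data.List.Relation.Unary.All using (All; []; _∷_)
open import Data.Nat using (ℕ; zero; suc; _<_)
import Data.Nat.Properties as ℕ
open import Data.Product using (_×_; _,_; proj₁; proj₂)
open import Data.Sum using (_⊎_; inj₁; inj₂)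
open import Data.Unit using (tt)
open import Data.Vec using (tabulate)
open import Data.Vec.Properties using (lookup∘tabulate; []=⇒lookup; lookup⇒[]=)
open import Function using (_∘_; flip; _⇔_; mk⇔; Equivalence)
open import Induction.WellFounded using (WellFounded; Acc; acc)
open import Relation.Binary.Structures using (IsStrictPartialOrder)
open import Relation.Binary.PropositionalEquality
  using (_≡_; _≢_; refl; sym; trans; cong; cong₂; subst; resp₂; module ≡-Reasoning)
open import Relation.Binary.PropositionalEquality.Properties using (isEquivalence)
open import Relation.Nullary using (¬_; yes; no)
open import Relation.Nullary.Decidable using (⌊_⌋; toWitnessFalse; fromWitnessFalse; ⌊⌋-map′)

open import Algebra.Properties.Semiring.Sum ℤ.+-*-semiring
  using (sum; sum-cong-≗; sum-replicate-zero; ∑-distrib-+; ∑-comm; *-distribˡ-sum; *-distribʳ-sum)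
open import Algebra.Properties.AbelianGroup ℤ.+-0-abelianGroup using (∙-cancelʳ)
open import Algebra.Properties.CommutativeSemigroup ℤ.+-commutativeSemigroup
  using () renaming (x∙yz≈y∙xz to x+[y+z]≡y+[x+z])
open import Algebra.Properties.CommutativeSemigroup ℤ.*-commutativeSemigroup
  using () renaming (xy∙z≈x∙zy to [x*y]*z≡x*[z*y])
open import Algebra.Properties.CommutativeSemigroup (CommutativeMonoid.commutativeSemigroup ∧-commutativeMonoid)
  using () renaming (xy∙z≈xz∙y to [x∧y]∧z≡[x∧z]∧y)

open Equivalence using (to; from)
open ≡-Reasoning

T-injective : ∀ {a b} → T a ⇔ T b → a ≡ b
T-injective Ta⇔Tb = ⇔→≡ {z = true}
  (mk⇔ (to T-≡ ∘ to Ta⇔Tb ∘ from T-≡) (to T-≡ ∘ from Ta⇔Tb ∘ from T-≡))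

⟦∧⟧ : ∀ a b → ⟦ a ∧ b ⟧ ≡ ⟦ a ⟧ * ⟦ b ⟧
⟦∧⟧ true  b = sym (*-identityˡ ⟦ b ⟧)
⟦∧⟧ false b = refl

⟦⟧*-cong : ∀ b {m n} → (T b → m ≡ n) → ⟦ b ⟧ * m ≡ ⟦ b ⟧ * n
⟦⟧*-cong true  m≡n = cong (+ 1 *_) (m≡n tt)
⟦⟧*-cong false m≡n = refl

∈-tabulate : ∀ {n} {f : Fin n → Bool} {x} → x ∈ tabulate f ⇔ T (f x)
∈-tabulate {f = f} {x} = mk⇔
  (λ x∈ → from T-≡ (trans (sym (lookup∘tabulate f x)) ([]=⇒lookup x∈)))
  (λ fx → lookup⇒[]= x (tabulate f) (trans (lookup∘tabulate f x) (to T-≡ fx)))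

sumFin≡sum : ∀ {n} (f : Fin n → ℤ) → sumFin f ≡ sum f
sumFin≡sum {zero}  f = refl
sumFin≡sum {suc n} f = cong (_+_ (f zero)) (sumFin≡sum (f ∘ suc))

-- The length is a module parameter because unification cannot recover it
-- from a sumFin application.
module SumFin (n : ℕ) where

  sumFin-cong : {f g : Fin n → ℤ} → (∀ i → f i ≡ g i) → sumFin f ≡ sumFin g
  sumFin-cong {f} {g} f≗g = begin
    sumFin f ≡⟨ sumFin≡sum f ⟩
    sum f    ≡⟨ sum-cong-≗ f≗g ⟩
    sum g    ≡⟨ sumFin≡sum g ⟨
    sumFin g ∎

  sumFin-zero : {f : Fin n → ℤ} → (∀ i → f i ≡ + 0) → sumFin f ≡ + 0
  sumFin-zero f≗0 = trans (sumFin-cong f≗0) (trans (sumFin≡sum {n} (λ _ → + 0)) (sum-replicate-zero n))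

  sumFin-+ : (f g : Fin n → ℤ) → sumFin (λ i → f i + g i) ≡ sumFin f + sumFin g
  sumFin-+ f g = begin
    sumFin (λ i → f i + g i) ≡⟨ sumFin≡sum (λ i → f i + g i) ⟩
    sum (λ i → f i + g i)    ≡⟨ ∑-distrib-+ f g ⟩
    sum f + sum g            ≡⟨ cong₂ _+_ (sumFin≡sum f) (sumFin≡sum g) ⟨
    sumFin f + sumFin g      ∎

  *-distribˡ-sumFin : ∀ a (f : Fin n → ℤ) → a * sumFin f ≡ sumFin (λ i → a * f i)
  *-distribˡ-sumFin a f = begin
    a * sumFin f           ≡⟨ cong (a *_) (sumFin≡sum f) ⟩
    a * sum f              ≡⟨ *-distribˡ-sum a f ⟩
    sum (λ i → a * f i)    ≡⟨ sumFin≡sum (λ i → a * f i) ⟨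
    sumFin (λ i → a * f i) ∎

  *-distribʳ-sumFin : ∀ a (f : Fin n → ℤ) → sumFin f * a ≡ sumFin (λ i → f i * a)
  *-distribʳ-sumFin a f = begin
    sumFin f * a           ≡⟨ cong (_* a) (sumFin≡sum f) ⟩
    sum f * a              ≡⟨ *-distribʳ-sum a f ⟩
    sum (λ i → f i * a)    ≡⟨ sumFin≡sum (λ i → f i * a) ⟨
    sumFin (λ i → f i * a) ∎

  sumFin-comm : (f : Fin n → Fin n → ℤ) →
                sumFin (λ i → sumFin (λ j → f i j)) ≡ sumFin (λ j → sumFin (λ i → f i j))
  sumFin-comm f = begin
    sumFin (λ i → sumFin (λ j → f i j))
      ≡⟨ trans (sumFin≡sum (λ i → sumFin (f i))) (sum-cong-≗ (λ i → sumFin≡sum (f i))) ⟩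
    sum (λ i → sum (λ j → f i j))
      ≡⟨ ∑-comm f ⟩
    sum (λ j → sum (λ i → f i j))
      ≡⟨ trans (sumFin≡sum (λ j → sumFin (λ i → f i j)))
               (sum-cong-≗ (λ j → sumFin≡sum (λ i → f i j))) ⟨
    sumFin (λ j → sumFin (λ i → f i j)) ∎

sumFin-δ : ∀ {n} (x : Fin n) (f : Fin n → ℤ) → sumFin (λ z → ⟦ ⌊ x ≟ z ⌋ ⟧ * f z) ≡ f x
sumFin-δ {suc n} zero f =
  trans (cong₂ _+_ (*-identityˡ (f zero)) (SumFin.sumFin-zero n (λ _ → refl))) (+-identityʳ (f zero))
sumFin-δ (suc x) f = begin
  + 0 + sumFin (λ z → ⟦ ⌊ suc x ≟ suc z ⌋ ⟧ * f (suc z))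
    ≡⟨ +-identityˡ _ ⟩
  sumFin (λ z → ⟦ ⌊ suc x ≟ suc z ⌋ ⟧ * f (suc z))
    ≡⟨ SumFin.sumFin-cong _ (λ z → cong (λ b → ⟦ b ⟧ * f (suc z))
                                        (⌊⌋-map′ (cong suc) suc-injective (x ≟ z))) ⟩
  sumFin (λ z → ⟦ ⌊ x ≟ z ⌋ ⟧ * f (suc z))
    ≡⟨ sumFin-δ x (f ∘ suc) ⟩
  f (suc x) ∎

module StrictOrder (P : FinPoset) where
  open FinPoset P using (size; leq; antisym) renaming (trans to leq-trans)

  _≤ₚ_ _<ₚ_ : Fin size → Fin size → Set
  x ≤ₚ y = T (leq x y)
  x <ₚ y = T (lt P x y)

  private variable
    x y z : Fin size

  <⇒≤ : x <ₚ y → x ≤ₚ y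
  <⇒≤ {x} {y} x<y = proj₁ (to (T-∧ {leq x y}) x<y)

  <⇒≢ : x <ₚ y → x ≢ y
  <⇒≢ {x} {y} x<y = toWitnessFalse (proj₂ (to (T-∧ {leq x y}) x<y))

  ≤∧≢⇒< : x ≤ₚ y → x ≢ y → x <ₚ y
  ≤∧≢⇒< x≤y x≢y = from T-∧ (x≤y , fromWitnessFalse x≢y)

  <-irrefl : ¬ x <ₚ x
  <-irrefl x<x = <⇒≢ x<x refl

  <-≤-trans : x <ₚ y → y ≤ₚ z → x <ₚ z
  <-≤-trans {x} {y} {z} x<y y≤z = ≤∧≢⇒< (leq-trans x y z (<⇒≤ x<y) y≤z) x≢z
    where
    x≢z : x ≢ z
    x≢z refl = <⇒≢ x<y (antisym x y (<⇒≤ x<y) y≤z)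

  <-trans : x <ₚ y → y <ₚ z → x <ₚ z
  <-trans x<y y<z = <-≤-trans x<y (<⇒≤ y<z)

  <-isStrictPartialOrder : IsStrictPartialOrder _≡_ _<ₚ_
  <-isStrictPartialOrder = record
    { isEquivalence = isEquivalence
    ; irrefl        = λ { refl → <-irrefl }
    ; trans         = <-trans
    ; <-resp-≈      = resp₂ _<ₚ_
    }

  >-wellFounded : WellFounded (flip _<ₚ_)
  >-wellFounded = spo-noetherian <-isStrictPartialOrder

  #above : Fin size → ℕ
  #above x = ∣ tabulate (lt P x) ∣

  #above<size : #above x < size
  #above<size {x} = subst (#above x <_) (∣⊤∣≡n size)
    (p⊂q⇒∣p∣<∣q∣ (⊆⊤ , x , ∈⊤ , <-irrefl ∘ to ∈-tabulate))

  #above-anti : x <ₚ y → #above y < #above x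
  #above-anti {x} {y} x<y = p⊂q⇒∣p∣<∣q∣
    ( (λ y<z → from ∈-tabulate (<-trans x<y (to ∈-tabulate y<z)))
    , y , from ∈-tabulate x<y , <-irrefl ∘ to ∈-tabulate )

module NeumannSeries (P : FinPoset) where
  open FinPoset P using (size)
  open SumFin size
  open StrictOrder P using (_<ₚ_; #above; #above<size; #above-anti)

  _▷_ : Mat P → (Fin size → ℤ) → Fin size → ℤ
  (M ▷ u) x = sumFin (λ y → M x y * u y)

  ▷-cong : ∀ M {u v} → (∀ y → u y ≡ v y) → ∀ x → (M ▷ u) x ≡ (M ▷ v) x
  ▷-cong M u≗v x = sumFin-cong (λ y → cong (M x y *_) (u≗v y))

  ▷-zero : ∀ M x → (M ▷ (λ _ → + 0)) x ≡ + 0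
  ▷-zero M x = sumFin-zero (λ y → *-zeroʳ (M x y))

  ▷-+ : ∀ M u v x → (M ▷ (λ y → u y + v y)) x ≡ (M ▷ u) x + (M ▷ v) x
  ▷-+ M u v x = trans (sumFin-cong (λ y → *-distribˡ-+ (M x y) (u y) (v y)))
                      (sumFin-+ (λ y → M x y * u y) (λ y → M x y * v y))

  ·-▷ : ∀ M N u x → (_·_ P M N ▷ u) x ≡ (M ▷ (N ▷ u)) x
  ·-▷ M N u x = begin
    sumFin (λ y → sumFin (λ z → M x z * N z y) * u y)
      ≡⟨ sumFin-cong (λ y → *-distribʳ-sumFin (u y) (λ z → M x z * N z y)) ⟩
    sumFin (λ y → sumFin (λ z → M x z * N z y * u y))
      ≡⟨ sumFin-comm (λ y z → M x z * N z y * u y) ⟩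
    sumFin (λ z → sumFin (λ y → M x z * N z y * u y))
      ≡⟨ sumFin-cong (λ z → sumFin-cong (λ y → *-assoc (M x z) (N z y) (u y))) ⟩
    sumFin (λ z → sumFin (λ y → M x z * (N z y * u y)))
      ≡⟨ sumFin-cong (λ z → *-distribˡ-sumFin (M x z) (λ y → N z y * u y)) ⟨
    sumFin (λ z → M x z * (N ▷ u) z) ∎

  idMat-▷ : ∀ u x → (idMat P ▷ u) x ≡ u x
  idMat-▷ u x = sumFin-δ x u

  neumann-zero-▷ : ∀ M u x → (neumann P M 0 ▷ u) x ≡ + 0
  neumann-zero-▷ M u x = sumFin-zero (λ _ → refl)

  neumann-suc-▷ : ∀ M k u x → (neumann P M (suc k) ▷ u) x ≡ (pow P M k ▷ u) x + (neumann P M k ▷ u) x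
  neumann-suc-▷ M k u x =
    trans (sumFin-cong (λ y → *-distribʳ-+ (u y) (pow P M k x y) (neumann P M k x y)))
          (sumFin-+ (λ y → pow P M k x y * u y) (λ y → neumann P M k x y * u y))

  neumann-unfold-▷ : ∀ M k u x → (neumann P M (suc k) ▷ u) x ≡ u x + (M ▷ (neumann P M k ▷ u)) x
  neumann-unfold-▷ M zero u x = begin
    (neumann P M 1 ▷ u) x                   ≡⟨ neumann-suc-▷ M 0 u x ⟩
    (idMat P ▷ u) x + (neumann P M 0 ▷ u) x ≡⟨ cong₂ _+_ (idMat-▷ u x) (neumann-zero-▷ M u x) ⟩
    u x + + 0                               ≡⟨ cong (_+_ (u x)) M▷N₀u≡0 ⟨
    u x + (M ▷ (neumann P M 0 ▷ u)) x        ∎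
    where
    M▷N₀u≡0 : (M ▷ (neumann P M 0 ▷ u)) x ≡ + 0
    M▷N₀u≡0 = trans (▷-cong M (neumann-zero-▷ M u) x) (▷-zero M x)
  neumann-unfold-▷ M (suc k) u x = begin
    (neumann P M (suc (suc k)) ▷ u) x
      ≡⟨ neumann-suc-▷ M (suc k) u x ⟩
    (pow P M (suc k) ▷ u) x + (neumann P M (suc k) ▷ u) x
      ≡⟨ cong₂ _+_ (·-▷ M (pow P M k) u x) (neumann-unfold-▷ M k u x) ⟩
    M▷Mᵏu + (u x + M▷Nₖu)
      ≡⟨ x+[y+z]≡y+[x+z] M▷Mᵏu (u x) M▷Nₖu ⟩
    u x + (M▷Mᵏu + M▷Nₖu)
      ≡⟨ cong (_+_ (u x)) (▷-+ M (pow P M k ▷ u) (neumann P M k ▷ u) x) ⟨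
    u x + (M ▷ (λ y → (pow P M k ▷ u) y + (neumann P M k ▷ u) y)) x
      ≡⟨ cong (_+_ (u x)) (▷-cong M (neumann-suc-▷ M k u) x) ⟨
    u x + (M ▷ (neumann P M (suc k) ▷ u)) x ∎
    where
    M▷Mᵏu M▷Nₖu : ℤ
    M▷Mᵏu = (M ▷ (pow P M k ▷ u)) x
    M▷Nₖu = (M ▷ (neumann P M k ▷ u)) x

  IsStrictlyUpper : Mat P → Set
  IsStrictlyUpper M = ∀ x y → M x y ≡ + 0 ⊎ x <ₚ y

  pow-nilpotent : ∀ {M} → IsStrictlyUpper M → ∀ k x y → #above x < k → pow P M k x y ≡ + 0
  pow-nilpotent {M} M-upper (suc k) x y #x<1+k = sumFin-zero term
    where
    term : ∀ z → M x z * pow P M k z y ≡ + 0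
    term z with M-upper x z
    ... | inj₁ Mxz≡0 = cong (_* pow P M k z y) Mxz≡0
    ... | inj₂ x<z   = trans (cong (M x z *_) (pow-nilpotent M-upper k z y #z<k)) (*-zeroʳ (M x z))
      where
      #z<k : #above z < k
      #z<k = ℕ.<-≤-trans (#above-anti x<z) (ℕ.≤-pred #x<1+k)

  neumann-fixpoint : ∀ {M} → IsStrictlyUpper M → ∀ u x →
                     (neumann P M size ▷ u) x ≡ u x + (M ▷ (neumann P M size ▷ u)) x
  neumann-fixpoint {M} M-upper u x = begin
    (neumann P M size ▷ u) x                        ≡⟨ +-identityˡ _ ⟨
    + 0 + (neumann P M size ▷ u) x                  ≡⟨ cong (_+ (neumann P M size ▷ u) x) Mⁿu≡0 ⟨
    (pow P M size ▷ u) x + (neumann P M size ▷ u) x ≡⟨ neumann-suc-▷ M size u x ⟨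
    (neumann P M (suc size) ▷ u) x                  ≡⟨ neumann-unfold-▷ M size u x ⟩
    u x + (M ▷ (neumann P M size ▷ u)) x            ∎
    where
    Mⁿu≡0 : (pow P M size ▷ u) x ≡ + 0
    Mⁿu≡0 = sumFin-zero (λ y → cong (_* u y) (pow-nilpotent M-upper size x y #above<size))

  negN-isStrictlyUpper : ∀ Q → IsStrictlyUpper (negN P Q)
  negN-isStrictlyUpper Q x y with lt P x y
  ... | true  = inj₂ tt
  ... | false rewrite ∧-zeroʳ (Q y) | ∧-zeroʳ (Q x) = inj₁ refl

module Weighting (P : FinPoset) where
  open FinPoset P using (size; leq) renaming (refl to leq-refl)
  open SumFin size
  open StrictOrder P using (_≤ₚ_; _<ₚ_; <-≤-trans; >-wellFounded)
  open NeumannSeries P using (_▷_; neumann-fixpoint; negN-isStrictlyUpper)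

  ∑[_]_ : Subset P → (Fin size → ℤ) → ℤ
  ∑[ S ] f = sumFin (λ x → ⟦ S x ⟧ * f x)

  ∑-cong : ∀ S {f g} → (∀ x → T (S x) → f x ≡ g x) → ∑[ S ] f ≡ ∑[ S ] g
  ∑-cong S f≗g = sumFin-cong (λ x → ⟦⟧*-cong (S x) (f≗g x))

  ∑-≗ : ∀ {S R} f → (∀ x → S x ≡ R x) → ∑[ S ] f ≡ ∑[ R ] f
  ∑-≗ f S≗R = sumFin-cong (λ x → cong (λ b → ⟦ b ⟧ * f x) (S≗R x))

  ∑-remove : ∀ S x f → ∑[ S ] f ≡ ⟦ S x ⟧ * f x + ∑[ remove P S x ] f
  ∑-remove S x f = begin
    ∑[ S ] f
      ≡⟨ sumFin-cong split ⟩
    sumFin (λ z → ⟦ ⌊ x ≟ z ⌋ ⟧ * (⟦ S z ⟧ * f z) + ⟦ remove P S x z ⟧ * f z)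
      ≡⟨ sumFin-+ (λ z → ⟦ ⌊ x ≟ z ⌋ ⟧ * (⟦ S z ⟧ * f z)) (λ z → ⟦ remove P S x z ⟧ * f z) ⟩
    sumFin (λ z → ⟦ ⌊ x ≟ z ⌋ ⟧ * (⟦ S z ⟧ * f z)) + ∑[ remove P S x ] f
      ≡⟨ cong (_+ ∑[ remove P S x ] f) (sumFin-δ x (λ z → ⟦ S z ⟧ * f z)) ⟩
    ⟦ S x ⟧ * f x + ∑[ remove P S x ] f ∎
    where
    split : ∀ z → ⟦ S z ⟧ * f z ≡ ⟦ ⌊ x ≟ z ⌋ ⟧ * (⟦ S z ⟧ * f z) + ⟦ remove P S x z ⟧ * f z
    split z with x ≟ z
    ... | yes refl rewrite ∧-zeroʳ (S x) = sym (trans (+-identityʳ _) (*-identityˡ _))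
    ... | no _     rewrite ∧-identityʳ (S z) = sym (+-identityˡ _)

  ∑-split : ∀ S x f → T (S x) → ∑[ S ] f ≡ f x + ∑[ remove P S x ] f
  ∑-split S x f x∈S = trans (∑-remove S x f)
    (cong (_+ ∑[ remove P S x ] f) (trans (cong (λ b → ⟦ b ⟧ * f x) (to T-≡ x∈S)) (*-identityˡ (f x))))

  ∑-remove-zero : ∀ S x f → f x ≡ + 0 → ∑[ S ] f ≡ ∑[ remove P S x ] f
  ∑-remove-zero S x f fx≡0 = begin
    ∑[ S ] f                                 ≡⟨ ∑-remove S x f ⟩
    ⟦ S x ⟧ * f x + ∑[ S∖x ] f               ≡⟨ cong (λ t → ⟦ S x ⟧ * t + ∑[ S∖x ] f) fx≡0 ⟩
    ⟦ S x ⟧ * + 0 + ∑[ S∖x ] f               ≡⟨ cong (_+ ∑[ S∖x ] f) (*-zeroʳ ⟦ S x ⟧) ⟩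
    + 0 + ∑[ S∖x ] f                         ≡⟨ +-identityˡ _ ⟩
    ∑[ S∖x ] f                               ∎
    where
    S∖x : Subset P
    S∖x = remove P S x

  atLeast : Subset P → Fin size → Subset P
  atLeast Q x z = Q z ∧ leq x z

  ∑-atLeast : ∀ Q x c → T (Q x) → ∑[ atLeast Q x ] c ≡ c x + ∑[ above P Q x ] c
  ∑-atLeast Q x c x∈Q = trans (∑-split (atLeast Q x) x c (from T-∧ (x∈Q , leq-refl x)))
    (cong (_+_ (c x)) (∑-≗ c (λ z → ∧-assoc (Q z) (leq x z) (not ⌊ x ≟ z ⌋))))

  record IsWeighting (Q : Subset P) (c : Fin size → ℤ) : Set where
    constructor isWeighting
    field
      ∑-atLeast≡1 : ∀ x → T (Q x) → ∑[ atLeast Q x ] c ≡ + 1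

  open IsWeighting

  weighting : Subset P → Fin size → ℤ
  weighting Q = zetaInv P Q ▷ (λ y → ⟦ Q y ⟧)

  negN-▷ : ∀ Q x → T (Q x) → ∀ u → (negN P Q ▷ u) x ≡ - ∑[ above P Q x ] u
  negN-▷ Q x x∈Q u rewrite to T-≡ x∈Q = begin
    sumFin (λ z → - ⟦ above P Q x z ⟧ * u z)
      ≡⟨ sumFin-cong (λ z → trans (sym (neg-distribˡ-* ⟦ above P Q x z ⟧ (u z))) (sym (-1*i≡-i _))) ⟩
    sumFin (λ z → -1ℤ * (⟦ above P Q x z ⟧ * u z))
      ≡⟨ *-distribˡ-sumFin -1ℤ (λ z → ⟦ above P Q x z ⟧ * u z) ⟨
    -1ℤ * ∑[ above P Q x ] u
      ≡⟨ -1*i≡-i _ ⟩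
    - ∑[ above P Q x ] u ∎

  weighting-isWeighting : ∀ Q → IsWeighting Q (weighting Q)
  weighting-isWeighting Q = isWeighting ∑-atLeast-w≡1
    where
    w : Fin size → ℤ
    w = weighting Q

    ∑-atLeast-w≡1 : ∀ x → T (Q x) → ∑[ atLeast Q x ] w ≡ + 1
    ∑-atLeast-w≡1 x x∈Q = begin
      ∑[ atLeast Q x ] w          ≡⟨ ∑-atLeast Q x w x∈Q ⟩
      w x + s                     ≡⟨ cong (_+ s) w-fix ⟩
      (+ 1 + - s) + s             ≡⟨ ℤ.+-assoc (+ 1) (- s) s ⟩
      + 1 + (- s + s)             ≡⟨ cong (_+_ (+ 1)) (ℤ.+-inverseˡ s) ⟩
      + 1                         ∎
      where
      s : ℤ
      s = ∑[ above P Q x ] w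
      w-fix : w x ≡ + 1 + - s
      w-fix = trans (neumann-fixpoint (negN-isStrictlyUpper Q) (λ y → ⟦ Q y ⟧) x)
        (cong₂ _+_ (cong ⟦_⟧ (to T-≡ x∈Q)) (negN-▷ Q x x∈Q w))

  weighting-unique : ∀ Q {c c′} → IsWeighting Q c → IsWeighting Q c′ → ∀ x → T (Q x) → c x ≡ c′ x
  weighting-unique Q {c} {c′} c-w c′-w x = go (>-wellFounded x)
    where
    go : ∀ {x} → Acc (flip _<ₚ_) x → T (Q x) → c x ≡ c′ x
    go {x} (acc rec) x∈Q = ∙-cancelʳ (∑[ above P Q x ] c) (c x) (c′ x) (begin
      c x + ∑[ above P Q x ] c    ≡⟨ ∑-atLeast Q x c x∈Q ⟨
      ∑[ atLeast Q x ] c          ≡⟨ ∑-atLeast≡1 c-w x x∈Q ⟩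
      + 1                         ≡⟨ ∑-atLeast≡1 c′-w x x∈Q ⟨
      ∑[ atLeast Q x ] c′         ≡⟨ ∑-atLeast Q x c′ x∈Q ⟩
      c′ x + ∑[ above P Q x ] c′  ≡⟨ cong (_+_ (c′ x)) (∑-cong (above P Q x) above-agree) ⟨
      c′ x + ∑[ above P Q x ] c   ∎)
      where
      above-agree : ∀ z → T (above P Q x z) → c z ≡ c′ z
      above-agree z z∈ = let z∈Q , x<z = to (T-∧ {Q z}) z∈ in go (rec x<z) z∈Q

  χ≡∑weighting : ∀ Q → χ P Q ≡ ∑[ Q ] (weighting Q)
  χ≡∑weighting Q = begin
    sumFin (λ x → sumFin (λ y → ⟦ Q x ∧ Q y ⟧ * ζ⁻¹ x y))
      ≡⟨ sumFin-cong (λ x → sumFin-cong (λ y →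
           trans (cong (_* ζ⁻¹ x y) (⟦∧⟧ (Q x) (Q y)))
                 ([x*y]*z≡x*[z*y] ⟦ Q x ⟧ ⟦ Q y ⟧ (ζ⁻¹ x y)))) ⟩
    sumFin (λ x → sumFin (λ y → ⟦ Q x ⟧ * (ζ⁻¹ x y * ⟦ Q y ⟧)))
      ≡⟨ sumFin-cong (λ x → *-distribˡ-sumFin ⟦ Q x ⟧ (λ y → ζ⁻¹ x y * ⟦ Q y ⟧)) ⟨
    ∑[ Q ] (weighting Q) ∎
    where
    ζ⁻¹ : Mat P
    ζ⁻¹ = zetaInv P Q

  isWeighting⇒χ≡∑ : ∀ Q {c} → IsWeighting Q c → χ P Q ≡ ∑[ Q ] c
  isWeighting⇒χ≡∑ Q c-w = trans (χ≡∑weighting Q)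
    (∑-cong Q (weighting-unique Q (weighting-isWeighting Q) c-w))

  IsFilterIn : Subset P → Subset P → Set
  IsFilterIn Q R = (∀ x → T (R x) → T (Q x)) × (∀ x y → T (R x) → T (Q y) → x ≤ₚ y → T (R y))

  isFilter⇒isFilterIn : ∀ {R} → IsFilter P R → IsFilterIn (full P) R
  isFilter⇒isFilterIn R-filter = (λ _ _ → tt) , (λ x y x∈R _ → R-filter x y x∈R)

  above-isFilterIn : ∀ Q x → IsFilterIn Q (above P Q x)
  above-isFilterIn Q x =
    (λ y y∈ → proj₁ (to (T-∧ {Q y}) y∈)) ,
    (λ y z y∈ z∈Q y≤z → from T-∧ (z∈Q , <-≤-trans (proj₂ (to (T-∧ {Q y}) y∈)) y≤z))

  isWeighting-filterIn : ∀ {Q R c} → IsFilterIn Q R → IsWeighting Q c → IsWeighting R c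
  isWeighting-filterIn {Q} {R} {c} (R⊆Q , R-up) c-w = isWeighting λ x x∈R →
    trans (∑-≗ c (same-atLeast x x∈R)) (∑-atLeast≡1 c-w x (R⊆Q x x∈R))
    where
    same-atLeast : ∀ x → T (R x) → ∀ z → atLeast R x z ≡ atLeast Q x z
    same-atLeast x x∈R z = T-injective (mk⇔
      (λ z∈ → let z∈R , x≤z = to (T-∧ {R z}) z∈ in from T-∧ (R⊆Q z z∈R , x≤z))
      (λ z∈ → let z∈Q , x≤z = to (T-∧ {Q z}) z∈ in from T-∧ (R-up x z x∈R z∈Q x≤z , x≤z)))

  isChiPoint⇒weight≡0 : ∀ Q {c} x → IsWeighting Q c → IsChiPoint P Q x → c x ≡ + 0
  isChiPoint⇒weight≡0 Q {c} x c-w (x∈Q , χ-above≡1) = ∙-cancelʳ (+ 1) (c x) (+ 0) (begin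
    c x + + 1                     ≡⟨ cong (_+_ (c x)) χ-above≡1 ⟨
    c x + χ P (above P Q x)       ≡⟨ cong (_+_ (c x)) (isWeighting⇒χ≡∑ (above P Q x) c-w-above) ⟩
    c x + ∑[ above P Q x ] c      ≡⟨ ∑-atLeast Q x c x∈Q ⟨
    ∑[ atLeast Q x ] c            ≡⟨ ∑-atLeast≡1 c-w x x∈Q ⟩
    + 1                           ∎)
    where
    c-w-above : IsWeighting (above P Q x) c
    c-w-above = isWeighting-filterIn (above-isFilterIn Q x) c-w

  isWeighting-remove : ∀ Q {c} x → IsWeighting Q c → c x ≡ + 0 → IsWeighting (remove P Q x) c
  isWeighting-remove Q {c} x c-w cx≡0 = isWeighting λ y y∈ → begin
    ∑[ atLeast (remove P Q x) y ] c
      ≡⟨ ∑-≗ c (λ z → [x∧y]∧z≡[x∧z]∧y (Q z) (not ⌊ x ≟ z ⌋) (leq y z)) ⟩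
    ∑[ remove P (atLeast Q y) x ] c
      ≡⟨ ∑-remove-zero (atLeast Q y) x c cx≡0 ⟨
    ∑[ atLeast Q y ] c
      ≡⟨ ∑-atLeast≡1 c-w y (proj₁ (to (T-∧ {Q y}) y∈)) ⟩
    + 1 ∎

  ChiReduces⇒∑≡ : ∀ {Q R c} → ChiReduces P Q R → IsWeighting Q c → (f : Fin size → ℤ) →
                 ∑[ Q ] (λ x → f x * c x) ≡ ∑[ R ] (λ x → f x * c x)
  ChiReduces⇒∑≡ (done _) c-w f = refl
  ChiReduces⇒∑≡ {Q} {c = c} (step x x-χ rest) c-w f =
    trans (∑-remove-zero Q x (λ y → f y * c y) (trans (cong (f x *_) cx≡0) (*-zeroʳ (f x))))
          (ChiReduces⇒∑≡ rest (isWeighting-remove Q x c-w cx≡0) f)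
    where
    cx≡0 : c x ≡ + 0
    cx≡0 = isChiPoint⇒weight≡0 Q x c-w x-χ

  valueDecomp≡∑ : ∀ {c} → IsWeighting (full P) c → ∀ d → All (λ aQ → IsFilter P (proj₂ aQ)) d →
                  valueDecomp P d ≡ sumFin (λ x → evalDecomp P d x * c x)
  valueDecomp≡∑ c-w []                []                   = sym (sumFin-zero (λ _ → refl))
  valueDecomp≡∑ {c} c-w ((a , Q) ∷ d) (Q-filter ∷ d-filters) = begin
    a * χ P Q + valueDecomp P d
      ≡⟨ cong₂ (λ s t → a * s + t)
           (isWeighting⇒χ≡∑ Q (isWeighting-filterIn (isFilter⇒isFilterIn Q-filter) c-w))
           (valueDecomp≡∑ c-w d d-filters) ⟩
    a * ∑[ Q ] c + sumFin (λ x → evalDecomp P d x * c x)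
      ≡⟨ cong (_+ sumFin (λ x → evalDecomp P d x * c x)) (*-distribˡ-sumFin a (λ x → ⟦ Q x ⟧ * c x)) ⟩
    sumFin (λ x → a * (⟦ Q x ⟧ * c x)) + sumFin (λ x → evalDecomp P d x * c x)
      ≡⟨ sumFin-+ (λ x → a * (⟦ Q x ⟧ * c x)) (λ x → evalDecomp P d x * c x) ⟨
    sumFin (λ x → a * (⟦ Q x ⟧ * c x) + evalDecomp P d x * c x)
      ≡⟨ sumFin-cong (λ x → trans (cong (_+ evalDecomp P d x * c x) (sym (*-assoc a ⟦ Q x ⟧ (c x))))
                                  (sym (*-distribʳ-+ (c x) (a * ⟦ Q x ⟧) (evalDecomp P d x)))) ⟩
    sumFin (λ x → (a * ⟦ Q x ⟧ + evalDecomp P d x) * c x) ∎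

  EulerIntegral⇒≡∑ : ∀ {c h v} → IsWeighting (full P) c → EulerIntegral P h v →
                    v ≡ ∑[ full P ] (λ x → h x * c x)
  EulerIntegral⇒≡∑ {c} {h} {v} c-w (d , (d-filters , h≗d) , d≡v) = begin
    v                                        ≡⟨ d≡v ⟨
    valueDecomp P d                          ≡⟨ valueDecomp≡∑ c-w d d-filters ⟩
    sumFin (λ x → evalDecomp P d x * c x)    ≡⟨ sumFin-cong (λ x → cong (_* c x) (h≗d x)) ⟨
    sumFin (λ x → h x * c x)                 ≡⟨ sumFin-cong (λ x → *-identityˡ (h x * c x)) ⟨
    ∑[ full P ] (λ x → h x * c x)            ∎

corollary4p2 : (P : FinPoset) (Pχ : Subset P) → IsChiMinimalModel P Pχ →
    (h h′ : Fin (FinPoset.size P) → ℤ) →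
    (∀ x → T (Pχ x) → h x ≡ h′ x) →
    ∀ v v′ → EulerIntegral P h v → EulerIntegral P h′ v′ → v ≡ v′
corollary4p2 P Pχ P↝Pχ h h′ h≗h′ v v′ ∫h ∫h′ = begin
  v                               ≡⟨ EulerIntegral⇒≡∑ w-isWeighting ∫h ⟩
  ∑[ full P ] (λ x → h x * w x)   ≡⟨ ChiReduces⇒∑≡ P↝Pχ w-isWeighting h ⟩
  ∑[ Pχ ] (λ x → h x * w x)       ≡⟨ ∑-cong Pχ (λ x x∈Pχ → cong (_* w x) (h≗h′ x x∈Pχ)) ⟩
  ∑[ Pχ ] (λ x → h′ x * w x)      ≡⟨ ChiReduces⇒∑≡ P↝Pχ w-isWeighting h′ ⟨
  ∑[ full P ] (λ x → h′ x * w x)  ≡⟨ EulerIntegral⇒≡∑ w-isWeighting ∫h′ ⟨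
  v′                              ∎
  where
  open Weighting P
  w : Fin (FinPoset.size P) → ℤ
  w = weighting (full P)
  w-isWeighting : IsWeighting (full P) w
  w-isWeighting = weighting-isWeighting (full P)
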